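{- Let $(L_1,\le_1)$ and $(L_2,\le_2)$ be linear orders, let $R=L_1\cap L_2$, and assume $\le_1$ and $\le_2$ coincide on $R$. Then there exists a linear order $\le$ on $L_1\cup L_2$ extending both $\le_1$ and $\le_2$ and satisfying, for all $l_1\in L_1\setminus R$ and $l_2\in L_2\setminus R$: $l_1<l_2$ if and only if there exists $r\in R$ with $l_1<_1 r<_2 l_2$. -}

module Defs where

open import Data.Product using (_×_)
open import Data.Sum using (_⊎_)
open import Relation.Nullary using (¬_)
open import Relation.Binary.PropositionalEquality using (_≡_; _≢_)
open import Relation.Unary using (Pred; _∈_)
open import Function.Bundles using (_⇔_)

record IsLinearOrderOn {X : Set} (S : Pred X _) (_≤_ : X → X → Set) : Set where
  field
    reflexive : ∀ {x} → x ∈ S → x ≤ x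
    antisym   : ∀ {x y} → x ∈ S → y ∈ S → x ≤ y → y ≤ x → x ≡ y
    trans     : ∀ {x y z} → x ∈ S → y ∈ S → z ∈ S → x ≤ y → y ≤ z → x ≤ z
    total     : ∀ {x y} → x ∈ S → y ∈ S → (x ≤ y) ⊎ (y ≤ x)

Strict : {X : Set} → (X → X → Set) → X → X → Set
Strict _≤_ x y = (x ≤ y) × (x ≢ y)

AgreeOn : {X : Set} → Pred X _ → (X → X → Set) → (X → X → Set) → Set
AgreeOn S _≤ₐ_ _≤ᵦ_ = ∀ {x y} → x ∈ S → y ∈ S → (x ≤ₐ y) ⇔ (x ≤ᵦ y)

-- On L₁ ∪ L₂ use ≤₁ and ≤₂ wherever they apply. An element a ∈ L₁ \ R is put
-- below b ∈ L₂ \ R exactly when some r ∈ R has a ≤₁ r ≤₂ b, and above it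
-- otherwise. Transitivity then rests on the composite relation "≤₁ then ≤₂
-- through R" being monotone on both sides, and totality on deciding
-- membership and this composite relation by excluded middle.
module Submission where

open import Defs
open import Level using (0ℓ)
open import Data.Product using (_×_; ∃-syntax; _,_)
open import Data.Sum as Sum using (_⊎_; inj₁; inj₂)
open import Relation.Nullary using (¬_; yes; no; contradiction)
open import Relation.Unary using (Pred; _∈_; _∉_; _∩_; _∪_)
open import Relation.Binary.PropositionalEquality using (_≡_; _≢_; refl; subst; ≢-sym)
open import Function.Bundles using (_⇔_; mk⇔; Equivalence)
import Function.Properties.Equivalence as ⇔
open import Axiom.ExcludedMiddle using (ExcludedMiddle)

∉∈⇒≢ : ∀ {X : Set} {P : Pred X 0ℓ} {x y} → x ∉ P → y ∈ P → x ≢ y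
∉∈⇒≢ x∉ y∈ refl = x∉ y∈

module MergedOrder {X : Set} (L₁ L₂ : Pred X 0ℓ) (_≤₁_ _≤₂_ : X → X → Set)
  (O₁ : IsLinearOrderOn L₁ _≤₁_) (O₂ : IsLinearOrderOn L₂ _≤₂_)
  (agree : AgreeOn (L₁ ∩ L₂) _≤₁_ _≤₂_) where

  open IsLinearOrderOn O₁ renaming
    (reflexive to refl₁; antisym to antisym₁; trans to trans₁; total to total₁)
  open IsLinearOrderOn O₂ renaming
    (reflexive to refl₂; antisym to antisym₂; trans to trans₂; total to total₂)

  R : Pred X 0ℓ
  R = L₁ ∩ L₂

  ≤₁⇒≤₂ : ∀ {x y} → x ∈ R → y ∈ R → x ≤₁ y → x ≤₂ y
  ≤₁⇒≤₂ xR yR = Equivalence.to (agree xR yR)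

  ≤₂⇒≤₁ : ∀ {x y} → x ∈ R → y ∈ R → x ≤₂ y → x ≤₁ y
  ≤₂⇒≤₁ xR yR = Equivalence.from (agree xR yR)

  infix 4 _≤₁₂_ _≤_

  _≤₁₂_ : X → X → Set
  x ≤₁₂ y = ∃[ r ] (r ∈ R × x ≤₁ r × r ≤₂ y)

  ≤₁₂-refl : ∀ {x} → x ∈ R → x ≤₁₂ x
  ≤₁₂-refl xR@(x₁ , x₂) = _ , xR , refl₁ x₁ , refl₂ x₂

  ≤₁-≤₁₂-trans : ∀ {x y z} → x ∈ L₁ → y ∈ L₁ → x ≤₁ y → y ≤₁₂ z → x ≤₁₂ z
  ≤₁-≤₁₂-trans x₁ y₁ x≤y (r , rR@(r₁ , _) , y≤r , r≤z) =
    r , rR , trans₁ x₁ y₁ r₁ x≤y y≤r , r≤z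

  ≤₁₂-≤₂-trans : ∀ {x y z} → y ∈ L₂ → z ∈ L₂ → x ≤₁₂ y → y ≤₂ z → x ≤₁₂ z
  ≤₁₂-≤₂-trans y₂ z₂ (r , rR@(_ , r₂) , x≤r , r≤y) y≤z =
    r , rR , x≤r , trans₂ r₂ y₂ z₂ r≤y y≤z

  ≤₁₂⇒≤₁ : ∀ {x z} → x ∈ L₁ → z ∈ R → x ≤₁₂ z → x ≤₁ z
  ≤₁₂⇒≤₁ x₁ zR@(z₁ , _) (r , rR@(r₁ , _) , x≤r , r≤z) =
    trans₁ x₁ r₁ z₁ x≤r (≤₂⇒≤₁ rR zR r≤z)

  ≤₁₂⇒≤₂ : ∀ {x z} → x ∈ R → z ∈ L₂ → x ≤₁₂ z → x ≤₂ z
  ≤₁₂⇒≤₂ xR@(_ , x₂) z₂ (r , rR@(_ , r₂) , x≤r , r≤z) =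
    trans₂ x₂ r₂ z₂ (≤₁⇒≤₂ xR rR x≤r) r≤z

  ≤₁₂-≰₁₂⇒≤₁ : ∀ {x y z} → x ∈ L₁ → z ∈ L₁ → x ≤₁₂ y → ¬ z ≤₁₂ y → x ≤₁ z
  ≤₁₂-≰₁₂⇒≤₁ x₁ z₁ x≤y z≰y with total₁ x₁ z₁
  ... | inj₁ x≤z = x≤z
  ... | inj₂ z≤x = contradiction (≤₁-≤₁₂-trans z₁ x₁ z≤x x≤y) z≰y

  ≤₁₂-≰₁₂⇒≤₂ : ∀ {x y z} → x ∈ L₂ → z ∈ L₂ → y ≤₁₂ z → ¬ y ≤₁₂ x → x ≤₂ z
  ≤₁₂-≰₁₂⇒≤₂ x₂ z₂ y≤z y≰x with total₂ x₂ z₂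
  ... | inj₁ x≤z = x≤z
  ... | inj₂ z≤x = contradiction (≤₁₂-≤₂-trans z₂ x₂ y≤z z≤x) y≰x

  ≤₁₂⇔strict : ∀ {x y} → x ∉ L₂ → y ∉ L₁ →
               x ≤₁₂ y ⇔ (∃[ r ] (r ∈ R × Strict _≤₁_ x r × Strict _≤₂_ r y))
  ≤₁₂⇔strict x∉₂ y∉₁ = mk⇔
    (λ { (r , rR@(r₁ , r₂) , x≤r , r≤y) →
         r , rR , (x≤r , ∉∈⇒≢ x∉₂ r₂) , (r≤y , ≢-sym (∉∈⇒≢ y∉₁ r₁)) })
    (λ { (r , rR , (x≤r , _) , (r≤y , _)) → r , rR , x≤r , r≤y })

  data _≤_ (x y : X) : Set where
    lift₁       : x ∈ L₁ → y ∈ L₁ → x ≤₁ y → x ≤ y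
    lift₂       : x ∈ L₂ → y ∈ L₂ → x ≤₂ y → x ≤ y
    separated   : x ∈ L₁ → x ∉ L₂ → y ∉ L₁ → y ∈ L₂ → x ≤₁₂ y → x ≤ y
    unseparated : x ∉ L₁ → x ∈ L₂ → y ∈ L₁ → y ∉ L₂ → ¬ y ≤₁₂ x → x ≤ y

  ≤⇒≤₁ : ∀ {x y} → x ∈ L₁ → y ∈ L₁ → x ≤ y → x ≤₁ y
  ≤⇒≤₁ _  _  (lift₁ _ _ x≤y)             = x≤y
  ≤⇒≤₁ x₁ y₁ (lift₂ x₂ y₂ x≤y)           = ≤₂⇒≤₁ (x₁ , x₂) (y₁ , y₂) x≤y
  ≤⇒≤₁ _  y₁ (separated _ _ y∉₁ _ _)     = contradiction y₁ y∉₁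
  ≤⇒≤₁ x₁ _  (unseparated x∉₁ _ _ _ _)   = contradiction x₁ x∉₁

  ≤⇒≤₂ : ∀ {x y} → x ∈ L₂ → y ∈ L₂ → x ≤ y → x ≤₂ y
  ≤⇒≤₂ x₂ y₂ (lift₁ x₁ y₁ x≤y)           = ≤₁⇒≤₂ (x₁ , x₂) (y₁ , y₂) x≤y
  ≤⇒≤₂ _  _  (lift₂ _ _ x≤y)             = x≤y
  ≤⇒≤₂ x₂ _  (separated _ x∉₂ _ _ _)     = contradiction x₂ x∉₂
  ≤⇒≤₂ _  y₂ (unseparated _ _ _ y∉₂ _)   = contradiction y₂ y∉₂

  ≤⇒≤₁₂ : ∀ {x y} → x ∉ L₂ → y ∉ L₁ → x ≤ y → x ≤₁₂ y
  ≤⇒≤₁₂ _   y∉₁ (lift₁ _ y₁ _)            = contradiction y₁ y∉₁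
  ≤⇒≤₁₂ x∉₂ _   (lift₂ x₂ _ _)            = contradiction x₂ x∉₂
  ≤⇒≤₁₂ _   _   (separated _ _ _ _ x≤y)   = x≤y
  ≤⇒≤₁₂ x∉₂ _   (unseparated _ x₂ _ _ _)  = contradiction x₂ x∉₂

  ≤⇒≰₁₂ : ∀ {x y} → x ∉ L₁ → y ∉ L₂ → x ≤ y → ¬ y ≤₁₂ x
  ≤⇒≰₁₂ x∉₁ _   (lift₁ x₁ _ _)            = contradiction x₁ x∉₁
  ≤⇒≰₁₂ _   y∉₂ (lift₂ _ y₂ _)            = contradiction y₂ y∉₂
  ≤⇒≰₁₂ x∉₁ _   (separated x₁ _ _ _ _)    = contradiction x₁ x∉₁
  ≤⇒≰₁₂ _   _   (unseparated _ _ _ _ y≰x) = y≰x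

  ≤-refl : ∀ {x} → x ∈ L₁ ∪ L₂ → x ≤ x
  ≤-refl (inj₁ x₁) = lift₁ x₁ x₁ (refl₁ x₁)
  ≤-refl (inj₂ x₂) = lift₂ x₂ x₂ (refl₂ x₂)

  ≤-antisym : ∀ {x y} → x ≤ y → y ≤ x → x ≡ y
  ≤-antisym (lift₁ x₁ y₁ x≤y) y≤x = antisym₁ x₁ y₁ x≤y (≤⇒≤₁ y₁ x₁ y≤x)
  ≤-antisym (lift₂ x₂ y₂ x≤y) y≤x = antisym₂ x₂ y₂ x≤y (≤⇒≤₂ y₂ x₂ y≤x)
  ≤-antisym (separated _ x∉₂ y∉₁ _ x≤y) y≤x =
    contradiction x≤y (≤⇒≰₁₂ y∉₁ x∉₂ y≤x)
  ≤-antisym (unseparated x∉₁ _ _ y∉₂ y≰x) y≤x =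
    contradiction (≤⇒≤₁₂ y∉₂ x∉₁ y≤x) y≰x

  ≤-agrees₁ : AgreeOn L₁ _≤_ _≤₁_
  ≤-agrees₁ x₁ y₁ = mk⇔ (≤⇒≤₁ x₁ y₁) (lift₁ x₁ y₁)

  ≤-agrees₂ : AgreeOn L₂ _≤_ _≤₂_
  ≤-agrees₂ x₂ y₂ = mk⇔ (≤⇒≤₂ x₂ y₂) (lift₂ x₂ y₂)

  <⇔≤₁₂ : ∀ {x y} → x ∈ L₁ → x ∉ L₂ → y ∈ L₂ → y ∉ L₁ → Strict _≤_ x y ⇔ x ≤₁₂ y
  <⇔≤₁₂ x₁ x∉₂ y₂ y∉₁ = mk⇔
    (λ { (x≤y , _) → ≤⇒≤₁₂ x∉₂ y∉₁ x≤y })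
    (λ x≤y → separated x₁ x∉₂ y∉₁ y₂ x≤y , ∉∈⇒≢ x∉₂ y₂)

  module _ (em : ExcludedMiddle 0ℓ) where

    ≤₁₂⇒≤ : ∀ {x y} → x ∈ L₁ → y ∈ L₂ → x ≤₁₂ y → x ≤ y
    ≤₁₂⇒≤ {x} {y} x₁ y₂ x≤y with em {x ∈ L₂} | em {y ∈ L₁}
    ... | yes x₂  | _       = lift₂ x₂ y₂ (≤₁₂⇒≤₂ (x₁ , x₂) y₂ x≤y)
    ... | no _    | yes y₁  = lift₁ x₁ y₁ (≤₁₂⇒≤₁ x₁ (y₁ , y₂) x≤y)
    ... | no x∉₂  | no y∉₁  = separated x₁ x∉₂ y∉₁ y₂ x≤y

    ≰₁₂⇒≤ : ∀ {x y} → x ∈ L₂ → y ∈ L₁ → ¬ y ≤₁₂ x → x ≤ y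
    ≰₁₂⇒≤ {x} {y} x₂ y₁ y≰x with em {x ∈ L₁} | em {y ∈ L₂}
    ... | yes x₁  | _       = lift₁ x₁ y₁ (≤₁₂-≰₁₂⇒≤₁ x₁ y₁ (≤₁₂-refl (x₁ , x₂)) y≰x)
    ... | no _    | yes y₂  = lift₂ x₂ y₂ (≤₁₂-≰₁₂⇒≤₂ x₂ y₂ (≤₁₂-refl (y₁ , y₂)) y≰x)
    ... | no x∉₁  | no y∉₂  = unseparated x∉₁ x₂ y₁ y∉₂ y≰x

    ≤-trans : ∀ {x y z} → x ≤ y → y ≤ z → x ≤ z
    ≤-trans (lift₁ x₁ y₁ x≤y) (lift₁ _ z₁ y≤z) = lift₁ x₁ z₁ (trans₁ x₁ y₁ z₁ x≤y y≤z)
    ≤-trans (lift₁ x₁ y₁ x≤y) (lift₂ y₂ z₂ y≤z) = ≤₁₂⇒≤ x₁ z₂ (_ , (y₁ , y₂) , x≤y , y≤z)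
    ≤-trans (lift₁ x₁ y₁ x≤y) (separated _ _ _ z₂ y≤z) =
      ≤₁₂⇒≤ x₁ z₂ (≤₁-≤₁₂-trans x₁ y₁ x≤y y≤z)
    ≤-trans (lift₁ _ y₁ _) (unseparated y∉₁ _ _ _ _) = contradiction y₁ y∉₁
    ≤-trans {x} {y} {z} (lift₂ x₂ y₂ x≤y) (lift₁ y₁ z₁ y≤z) with em {z ∈ L₂}
    ... | yes z₂ = lift₂ x₂ z₂ (trans₂ x₂ y₂ z₂ x≤y (≤₁⇒≤₂ (y₁ , y₂) (z₁ , z₂) y≤z))
    ... | no z∉₂ = ≰₁₂⇒≤ x₂ z₁ z≰x
      where
      -- z ≤₁₂ x would give z ≤₁ y ≤₁ z, forcing z = y ∈ L₂.
      z≰x : ¬ z ≤₁₂ x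
      z≰x z≤x = z∉₂ (subst L₂ y≡z y₂)
        where
        y≡z : y ≡ z
        y≡z = antisym₁ y₁ z₁ y≤z (≤₁₂⇒≤₁ z₁ (y₁ , y₂) (≤₁₂-≤₂-trans x₂ y₂ z≤x x≤y))
    ≤-trans (lift₂ x₂ y₂ x≤y) (lift₂ _ z₂ y≤z) = lift₂ x₂ z₂ (trans₂ x₂ y₂ z₂ x≤y y≤z)
    ≤-trans (lift₂ _ y₂ _) (separated _ y∉₂ _ _ _) = contradiction y₂ y∉₂
    ≤-trans (lift₂ x₂ y₂ x≤y) (unseparated _ _ z₁ _ z≰y) =
      ≰₁₂⇒≤ x₂ z₁ (λ z≤x → z≰y (≤₁₂-≤₂-trans x₂ y₂ z≤x x≤y))
    ≤-trans (separated _ _ y∉₁ _ _) (lift₁ y₁ _ _) = contradiction y₁ y∉₁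
    ≤-trans (separated x₁ _ _ y₂ x≤y) (lift₂ _ z₂ y≤z) =
      ≤₁₂⇒≤ x₁ z₂ (≤₁₂-≤₂-trans y₂ z₂ x≤y y≤z)
    ≤-trans (separated _ _ y∉₁ _ _) (separated y₁ _ _ _ _) = contradiction y₁ y∉₁
    ≤-trans (separated x₁ _ _ _ x≤y) (unseparated _ _ z₁ _ z≰y) =
      lift₁ x₁ z₁ (≤₁₂-≰₁₂⇒≤₁ x₁ z₁ x≤y z≰y)
    ≤-trans (unseparated _ x₂ y₁ _ y≰x) (lift₁ _ z₁ y≤z) =
      ≰₁₂⇒≤ x₂ z₁ (λ z≤x → y≰x (≤₁-≤₁₂-trans y₁ z₁ y≤z z≤x))
    ≤-trans (unseparated _ _ _ y∉₂ _) (lift₂ y₂ _ _) = contradiction y₂ y∉₂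
    ≤-trans (unseparated _ x₂ _ _ y≰x) (separated _ _ _ z₂ y≤z) =
      lift₂ x₂ z₂ (≤₁₂-≰₁₂⇒≤₂ x₂ z₂ y≤z y≰x)
    ≤-trans (unseparated _ _ _ y∉₂ _) (unseparated _ y₂ _ _ _) = contradiction y₂ y∉₂

    ≤-total : ∀ {x y} → x ∈ L₁ ∪ L₂ → y ∈ L₁ ∪ L₂ → x ≤ y ⊎ y ≤ x
    ≤-total (inj₁ x₁) (inj₁ y₁) = Sum.map (lift₁ x₁ y₁) (lift₁ y₁ x₁) (total₁ x₁ y₁)
    ≤-total (inj₂ x₂) (inj₂ y₂) = Sum.map (lift₂ x₂ y₂) (lift₂ y₂ x₂) (total₂ x₂ y₂)
    ≤-total {x} {y} (inj₁ x₁) (inj₂ y₂) with em {x ≤₁₂ y}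
    ... | yes x≤y = inj₁ (≤₁₂⇒≤ x₁ y₂ x≤y)
    ... | no x≰y  = inj₂ (≰₁₂⇒≤ y₂ x₁ x≰y)
    ≤-total (inj₂ x₂) (inj₁ y₁) = Sum.swap (≤-total (inj₁ y₁) (inj₂ x₂))

    ≤-isLinearOrderOn : IsLinearOrderOn (L₁ ∪ L₂) _≤_
    ≤-isLinearOrderOn = record
      { reflexive = ≤-refl
      ; antisym   = λ _ _ → ≤-antisym
      ; trans     = λ _ _ _ → ≤-trans
      ; total     = ≤-total
      }

lemma1 : ExcludedMiddle 0ℓ →
         {X : Set} (L₁ L₂ : Pred X 0ℓ) (_≤₁_ _≤₂_ : X → X → Set) →
         IsLinearOrderOn L₁ _≤₁_ →
         IsLinearOrderOn L₂ _≤₂_ →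
         AgreeOn (L₁ ∩ L₂) _≤₁_ _≤₂_ →
         ∃[ _≤_ ] (IsLinearOrderOn (L₁ ∪ L₂) _≤_
                   × AgreeOn L₁ _≤_ _≤₁_
                   × AgreeOn L₂ _≤_ _≤₂_
                   × (∀ {l₁ l₂} → l₁ ∈ L₁ → l₁ ∉ L₂ → l₂ ∈ L₂ → l₂ ∉ L₁ →
                        Strict _≤_ l₁ l₂ ⇔
                        (∃[ r ] (r ∈ (L₁ ∩ L₂) × Strict _≤₁_ l₁ r × Strict _≤₂_ r l₂))))
lemma1 em L₁ L₂ _≤₁_ _≤₂_ O₁ O₂ agree =
  _≤_ , ≤-isLinearOrderOn em , ≤-agrees₁ , ≤-agrees₂ , <⇔strict
  where
  open MergedOrder L₁ L₂ _≤₁_ _≤₂_ O₁ O₂ agree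
  <⇔strict : ∀ {l₁ l₂} → l₁ ∈ L₁ → l₁ ∉ L₂ → l₂ ∈ L₂ → l₂ ∉ L₁ →
             Strict _≤_ l₁ l₂ ⇔ (∃[ r ] (r ∈ R × Strict _≤₁_ l₁ r × Strict _≤₂_ r l₂))
  <⇔strict l₁∈ l₁∉ l₂∈ l₂∉ = ⇔.trans (<⇔≤₁₂ l₁∈ l₁∉ l₂∈ l₂∉) (≤₁₂⇔strict l₁∉ l₂∉)
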